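{- Let $n\ge 1$ and consider the affine Weyl group $W=T(M)\rtimes W_0$ of type $A_n^{(1)}$ acting on $\mathfrak h^*$ as described in the context, together with the elements $\sigma_1,\dots,\sigma_n$. Then for every $w\in W$ and every $j\in\{1,\dots,n\}$: (1) $\mathcal L_{\Lambda_0}(w)=\mathcal L_{\Lambda_0}(\sigma_j w)=\mathcal L_{\Lambda_0}(\sigma_1^{\,j} w)$; (2) $\mathcal L_{\Lambda_0}(w f^j)=\mathcal L_{\Lambda_0}(\pi_j(w))$, where $f$ is the class of $\omega_1$ in $F=L/M$, $\pi_j(w):=\sigma_j^{ -1}w\sigma_j\in W$, and the extended atomic length of $wf^j\in W\rtimes F$ is defined by $\mathcal L_{\Lambda_0}(wf^j):=\mathcal L_{\Lambda_0}(\sigma_j\pi_j(w))$ $(=\mathcal L_{\Lambda_0}(w\sigma_j))$.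
   Context: Fix $n\ge1$, $h=n+1$. Let $V_0=\{x\in\mathbb R^{n+1}:\sum_i x_i=0\}$ with the standard inner product $(\cdot|\cdot)$, $|x|^2=(x|x)$, and standard basis vectors $\varepsilon_1,\dots,\varepsilon_{n+1}$. Simple roots $\alpha_i=\varepsilon_i-\varepsilon_{i+1}$ ($1\le i\le n$), $\theta=\alpha_1+\dots+\alpha_n$. Let $\mathfrak h^*=V_0\oplus\mathbb R\delta\oplus\mathbb R\Lambda_0$ ($\delta,\Lambda_0$ formal basis vectors) and $\alpha_0:=\delta-\theta$. The height $\mathrm{ht}$ is the linear form on $V_0\oplus\mathbb R\delta$ with $\mathrm{ht}(\alpha_i)=1$ for $0\le i\le n$ (so $\mathrm{ht}(\sum_{i\ge1}x_i\alpha_i)=\sum x_i$ and $\mathrm{ht}(\delta)=h$). Let $\langle\cdot,c\rangle$ be the linear form on $\mathfrak h^*$ vanishing on $V_0\oplus\mathbb R\delta$ with $\langle\Lambda_0,c\rangle=1$, and extend $(v|x)$ to $v\in\mathfrak h^*$, $x\in V_0$ by $(\delta|x)=(\Lambda_0|x)=0$. For $x\in V_0$ the translation $t_x\in GL(\mathfrak h^*)$ is $t_x(v)=v+\langle v,c\rangle x-\big((v|x)+\tfrac12|x|^2\langle v,c\rangle\big)\delta$. $W_0=S_{n+1}$ acts on $V_0$ by permuting coordinates and fixes $\delta,\Lambda_0$; $s_i$ is the transposition $(i,i+1)$. $M=V_0\cap\mathbb Z^{n+1}$, $W=T(M)\rtimes W_0$ is the group generated by the $t_q$ ($q\in M$)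 and $W_0$. Fundamental weights $\omega_j=(\varepsilon_1+\dots+\varepsilon_j)-\frac{j}{n+1}(\varepsilon_1+\dots+\varepsilon_{n+1})$, $L=\bigoplus_j\mathbb Z\omega_j$, $F=L/M$. For $g$ in the group generated by $W$ and all $t_x$ ($x\in L$), $\Lambda_0-g\Lambda_0\in V_0\oplus\mathbb R\delta$ and the $\Lambda_0$-atomic length is $\mathcal L_{\Lambda_0}(g)=\mathrm{ht}(\Lambda_0-g\Lambda_0)$. Let $w_0\in S_{n+1}$ be the longest element ($i\mapsto n+2-i$), and for $1\le j\le n$ let $w_{0,j}$ be the longest element of the parabolic subgroup $\langle s_k:k\neq j\rangle\cong S_j\times S_{n+1-j}$; set $\sigma_j:=t_{\omega_j}w_{0,j}w_0$. -}

module Defs where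

open import Data.Nat as ℕ using (ℕ; zero; suc; _∸_; _<ᵇ_; _≤ᵇ_; _<?_)
open import Data.Integer as ℤ using (ℤ; +_)
open import Data.Rational as ℚ using (ℚ; 0ℚ; 1ℚ; ½; _+_; _*_; _-_; -_; _/_)
open import Data.Fin as Fin using (Fin; zero; suc; toℕ; fromℕ<; opposite)
open import Data.Fin.Permutation using (Permutation′; _⟨$⟩ˡ_)
open import Data.Bool using (if_then_else_)
open import Relation.Nullary using (yes; no)
open import Relation.Binary.PropositionalEquality using (_≡_)
open import Data.Product using (_×_)
open import Function using (_∘_)

sumℚ : ∀ {m} → (Fin m → ℚ) → ℚ
sumℚ {zero}  f = 0ℚ
sumℚ {suc m} f = f zero + sumℚ (f ∘ suc)

sumℤ : ∀ {m} → (Fin m → ℤ) → ℤ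
sumℤ {zero}  f = + 0
sumℤ {suc m} f = f zero ℤ.+ sumℤ (f ∘ suc)

ℤ→ℚ : ℤ → ℚ
ℤ→ℚ z = z / 1

-- Elements of h* = V ⊕ ℝδ ⊕ ℝΛ₀ (coefficients in ℚ), for R^{n+1}, coordinates
-- indexed 0..n (0-indexed ε_{i+1}).  Elements of h* proper have Σ V = 0 (see InH).
record H (n : ℕ) : Set where
  constructor mkH
  field
    V : Fin (suc n) → ℚ
    d : ℚ                  -- δ-coefficient
    l : ℚ                  -- Λ₀-coefficient  (= ⟨v,c⟩)
open H public

InH : ∀ {n} → H n → Set
InH v = sumℚ (V v) ≡ 0ℚ

_≈H_ : ∀ {n} → H n → H n → Set
v ≈H w = (∀ k → V v k ≡ V w k) × (d v ≡ d w) × (l v ≡ l w)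

Λ₀ : ∀ {n} → H n
Λ₀ = mkH (λ _ → 0ℚ) 0ℚ 1ℚ

_-H_ : ∀ {n} → H n → H n → H n
v -H w = mkH (λ k → V v k - V w k) (d v - d w) (l v - l w)

inner : ∀ {n} → (Fin (suc n) → ℚ) → (Fin (suc n) → ℚ) → ℚ
inner x y = sumℚ (λ k → x k * y k)

t : ∀ {n} → (Fin (suc n) → ℚ) → H n → H n
t x v = mkH (λ k → V v k + l v * x k)
            (d v - (inner (V v) x + ½ * inner x x * l v))
            (l v)

-- action of a permutation u ∈ S_{n+1}, given by its inverse function uinv:
-- (u·x)_k = x_{u⁻¹(k)}, δ and Λ₀ fixed
permActInv : ∀ {n} → (Fin (suc n) → Fin (suc n)) → H n → H n
permActInv uinv v = mkH (λ k → V v (uinv k)) (d v) (l v)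

permAct : ∀ {n} → Permutation′ (suc n) → H n → H n
permAct π = permActInv (π ⟨$⟩ˡ_)

-- height: ht(Σ_{i=1}^n c_i α_i + a δ) = Σ c_i + (n+1) a.  For x ∈ V₀ the α-coefficient
-- c_k (k = 1..n) is x_1 + … + x_k; here 0-indexed: c_{k+1} = Σ_{i ≤ k} V i, k : Fin n.
αcoef : ∀ {n} → (Fin (suc n) → ℚ) → Fin n → ℚ
αcoef x k = sumℚ (λ i → if toℕ i ≤ᵇ toℕ k then x i else 0ℚ)

ht : ∀ {n} → H n → ℚ
ht {n} v = sumℚ (αcoef (V v)) + ℤ→ℚ (+ suc n) * d v

𝓛 : ∀ {n} → (H n → H n) → ℚ
𝓛 g = ht (Λ₀ -H g Λ₀)

record WElt (n : ℕ) : Set where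
  constructor mkW
  field
    q   : Fin (suc n) → ℤ
    q∈M : sumℤ q ≡ + 0
    u   : Permutation′ (suc n)
open WElt public

actW : ∀ {n} → WElt n → H n → H n
actW w = t (ℤ→ℚ ∘ q w) ∘ permAct (u w)

ω : (n j : ℕ) → Fin (suc n) → ℚ
ω n j i = (if toℕ i <ᵇ j then 1ℚ else 0ℚ) - (+ j / suc n)

-- ℕ → Fin (suc m), used only on values < suc m (fallback never reached)
toFin : ∀ m → ℕ → Fin (suc m)
toFin m k with k <? suc m
... | yes p = fromℕ< p
... | no _  = zero

w₀ : ∀ {n} → Fin (suc n) → Fin (suc n)
w₀ = opposite

-- longest element w_{0,j} of ⟨s_k : k ≠ j⟩ ≅ S_j × S_{n+1-j}: reverses the blocks
-- {1..j} and {j+1..n+1}; an involution.  0-indexed: i<j ↦ j-1-i, i≥j ↦ n+j-i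
w₀j : ∀ {n} → ℕ → Fin (suc n) → Fin (suc n)
w₀j {n} j i = toFin n (if toℕ i <ᵇ j then j ∸ 1 ∸ toℕ i else n ℕ.+ j ∸ toℕ i)

-- σ_j = t_{ω_j} w_{0,j} w₀ ; since both are involutions, (w_{0,j} w₀)⁻¹ = w₀ w_{0,j}
σ : (n j : ℕ) → H n → H n
σ n j = t (ω n j) ∘ permActInv (w₀ ∘ w₀j j)

σinv : (n j : ℕ) → H n → H n
σinv n j = permActInv (w₀j j ∘ w₀) ∘ t (λ k → - ω n j k)

πj : (n j : ℕ) → (H n → H n) → H n → H n
πj n j g = σinv n j ∘ g ∘ σ n j

iter : ∀ {A : Set} → (A → A) → ℕ → A → A
iter f zero    = λ x → x
iter f (suc k) = f ∘ iter f k

module Submission where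

-- Every element of W maps Λ₀ to a translate t_y Λ₀, and completing the square gives
-- ht(Λ₀ − t_y Λ₀) = (h/2)(|y − c|² − |c|²) with c_i = (n − i)/h (coordinates indexed from 0).
-- On such translates σ_j acts by y ↦ y ∘ (w₀ w_{0,j}) + ω_j, and the key identity
-- c ∘ (w₀ w_{0,j}) = c − ω_j says that y − c is merely permuted; so σ_j, and hence σ₁^j,
-- preserve the Λ₀-length, which is (1).  For (2), σ_j⁻¹ w σ_j is computed to be t_{q′} u′ with
-- q′ integral (the fractional parts −j/h of ω_j cancel), σ_j π_j(w) = w σ_j by construction,
-- and (1) applied to π_j(w) gives the last equality.

open import Defs
open import Data.Nat as ℕ using (ℕ; zero; suc; _∸_; _<ᵇ_; _≤ᵇ_; _<_; _≤_; z≤n; s≤s; _<?_)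
import Data.Nat.Properties as ℕP
open import Data.Integer as ℤ using (ℤ)
import Data.Integer.Properties as ℤP
open import Data.Rational as ℚ using (ℚ; 0ℚ; 1ℚ; ½; _+_; _*_; _-_; -_; _/_; toℚᵘ)
import Data.Rational.Properties as ℚP
import Data.Rational.Unnormalised as ℚᵘ
import Data.Rational.Unnormalised.Properties as ℚᵘP
open import Data.Rational.Solver using (module +-*-Solver)
open import Data.Fin using (Fin; zero; suc; toℕ)
import Data.Fin.Properties as FinP
open import Data.Fin.Permutation
  using (Permutation′; permutation; flip; reverse; _∘ₚ_; _⟨$⟩ʳ_; _⟨$⟩ˡ_; inverseˡ)
open import Data.Bool using (true; false; if_then_else_)
open import Data.Bool.Properties using (if-float)
open import Data.Product using (Σ; _×_; _,_)
open import Data.Empty using (⊥-elim)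
open import Relation.Nullary using (yes; no)
open import Relation.Nullary.Reflects using (ofʸ; ofⁿ)
open import Relation.Binary.PropositionalEquality hiding (J)
open import Relation.Binary.Bundles using (Setoid)
open import Level using (0ℓ)
open import Function using (_∘_)
open import Data.Vec.Functional using (Vector)
import Algebra.Properties.CommutativeMonoid.Sum as CommutativeMonoidSum

open +-*-Solver using (solve; _:=_; _:+_; _:*_; :-_; _:-_; con)

module Σℚ = CommutativeMonoidSum ℚP.+-0-commutativeMonoid

sumℚ-cong : ∀ {m} {f g : Fin m → ℚ} → (∀ k → f k ≡ g k) → sumℚ f ≡ sumℚ g
sumℚ-cong {zero}  f≗g = refl
sumℚ-cong {suc m} f≗g = cong₂ _+_ (f≗g zero) (sumℚ-cong (f≗g ∘ suc))

sumℚ-zero : ∀ m → sumℚ {m} (λ _ → 0ℚ) ≡ 0ℚ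
sumℚ-zero zero    = refl
sumℚ-zero (suc m) = cong (0ℚ +_) (sumℚ-zero m)

sumℚ-+ : ∀ {m} (f g : Fin m → ℚ) → sumℚ (λ k → f k + g k) ≡ sumℚ f + sumℚ g
sumℚ-+ {zero}  f g = refl
sumℚ-+ {suc m} f g = begin
  (f zero + g zero) + sumℚ (λ k → f (suc k) + g (suc k))
    ≡⟨ cong ((f zero + g zero) +_) (sumℚ-+ (f ∘ suc) (g ∘ suc)) ⟩
  (f zero + g zero) + (sumℚ (f ∘ suc) + sumℚ (g ∘ suc))
    ≡⟨ solve 4 (λ a b c d → (a :+ b) :+ (c :+ d) := (a :+ c) :+ (b :+ d)) refl
         (f zero) (g zero) (sumℚ (f ∘ suc)) (sumℚ (g ∘ suc)) ⟩
  (f zero + sumℚ (f ∘ suc)) + (g zero + sumℚ (g ∘ suc)) ∎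
  where open ≡-Reasoning

sumℚ-*ˡ : ∀ {m} (c : ℚ) (f : Fin m → ℚ) → sumℚ (λ k → c * f k) ≡ c * sumℚ f
sumℚ-*ˡ {zero}  c f = sym (ℚP.*-zeroʳ c)
sumℚ-*ˡ {suc m} c f = begin
  c * f zero + sumℚ (λ k → c * f (suc k)) ≡⟨ cong (c * f zero +_) (sumℚ-*ˡ c (f ∘ suc)) ⟩
  c * f zero + c * sumℚ (f ∘ suc)         ≡⟨ sym (ℚP.*-distribˡ-+ c (f zero) _) ⟩
  c * (f zero + sumℚ (f ∘ suc))           ∎
  where open ≡-Reasoning

sumℚ-neg : ∀ {m} (f : Fin m → ℚ) → sumℚ (λ k → - f k) ≡ - sumℚ f
sumℚ-neg {zero}  f = refl
sumℚ-neg {suc m} f = begin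
  - f zero + sumℚ (λ k → - f (suc k)) ≡⟨ cong (- f zero +_) (sumℚ-neg (f ∘ suc)) ⟩
  - f zero + - sumℚ (f ∘ suc)         ≡⟨ sym (ℚP.neg-distrib-+ (f zero) _) ⟩
  - (f zero + sumℚ (f ∘ suc))         ∎
  where open ≡-Reasoning

sumℚ≡sum : ∀ {m} (f : Fin m → ℚ) → sumℚ f ≡ Σℚ.sum f
sumℚ≡sum {zero}  f = refl
sumℚ≡sum {suc m} f = cong (f zero +_) (sumℚ≡sum (f ∘ suc))

sumℚ-comm : ∀ {m p} (f : Fin m → Fin p → ℚ) →
            sumℚ (λ i → sumℚ (f i)) ≡ sumℚ (λ k → sumℚ (λ i → f i k))
sumℚ-comm f = begin
  sumℚ (λ i → sumℚ (f i))                   ≡⟨ sumℚ-cong (λ i → sumℚ≡sum (f i)) ⟩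
  sumℚ (λ i → Σℚ.sum (f i))                 ≡⟨ sumℚ≡sum (λ i → Σℚ.sum (f i)) ⟩
  Σℚ.sum (λ i → Σℚ.sum (f i))               ≡⟨ Σℚ.∑-comm f ⟩
  Σℚ.sum (λ k → Σℚ.sum (λ i → f i k))       ≡⟨ sym (sumℚ≡sum (λ k → Σℚ.sum (λ i → f i k))) ⟩
  sumℚ (λ k → Σℚ.sum (λ i → f i k))         ≡⟨ sumℚ-cong (λ k → sym (sumℚ≡sum (λ i → f i k))) ⟩
  sumℚ (λ k → sumℚ (λ i → f i k))           ∎
  where open ≡-Reasoning

sumℚ-permute : ∀ {m} (π : Permutation′ m) (f : Fin m → ℚ) → sumℚ (f ∘ (π ⟨$⟩ʳ_)) ≡ sumℚ f
sumℚ-permute π f = begin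
  sumℚ (f ∘ (π ⟨$⟩ʳ_))    ≡⟨ sumℚ≡sum (f ∘ (π ⟨$⟩ʳ_)) ⟩
  Σℚ.sum (f ∘ (π ⟨$⟩ʳ_))  ≡⟨ sym (Σℚ.sum-permute f π) ⟩
  Σℚ.sum f                ≡⟨ sym (sumℚ≡sum f) ⟩
  sumℚ f                  ∎
  where open ≡-Reasoning

ℕ→ℚ : ℕ → ℚ
ℕ→ℚ m = ℤ→ℚ (ℤ.+ m)

toℚᵘ-ℤ→ℚ : ∀ z → toℚᵘ (ℤ→ℚ z) ℚᵘ.≃ ℚᵘ.mkℚᵘ z 0
toℚᵘ-ℤ→ℚ z = ℚP.toℚᵘ-fromℚᵘ (ℚᵘ.mkℚᵘ z 0)

ℤ→ℚ-+ : ∀ a b → ℤ→ℚ (a ℤ.+ b) ≡ ℤ→ℚ a + ℤ→ℚ b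
ℤ→ℚ-+ a b = ℚP.toℚᵘ-injective (begin
  toℚᵘ (ℤ→ℚ (a ℤ.+ b))              ≈⟨ toℚᵘ-ℤ→ℚ (a ℤ.+ b) ⟩
  ℚᵘ.mkℚᵘ (a ℤ.+ b) 0                ≈⟨ ℚᵘ.*≡* mkℚᵘ-+ ⟩
  ℚᵘ.mkℚᵘ a 0 ℚᵘ.+ ℚᵘ.mkℚᵘ b 0       ≈⟨ ℚᵘP.+-cong (toℚᵘ-ℤ→ℚ a) (toℚᵘ-ℤ→ℚ b) ⟨
  toℚᵘ (ℤ→ℚ a) ℚᵘ.+ toℚᵘ (ℤ→ℚ b)    ≈⟨ ℚP.toℚᵘ-homo-+ (ℤ→ℚ a) (ℤ→ℚ b) ⟨
  toℚᵘ (ℤ→ℚ a + ℤ→ℚ b)              ∎)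
  where
  open ℚᵘP.≃-Reasoning
  mkℚᵘ-+ : (a ℤ.+ b) ℤ.* ℤ.+ 1 ≡ (a ℤ.* ℤ.+ 1 ℤ.+ b ℤ.* ℤ.+ 1) ℤ.* ℤ.+ 1
  mkℚᵘ-+ = cong (ℤ._* ℤ.+ 1) (sym (cong₂ ℤ._+_ (ℤP.*-identityʳ a) (ℤP.*-identityʳ b)))

ℤ→ℚ-neg : ∀ a → ℤ→ℚ (ℤ.- a) ≡ - ℤ→ℚ a
ℤ→ℚ-neg a = ℚP.toℚᵘ-injective (begin
  toℚᵘ (ℤ→ℚ (ℤ.- a))       ≈⟨ toℚᵘ-ℤ→ℚ (ℤ.- a) ⟩
  ℚᵘ.- ℚᵘ.mkℚᵘ a 0          ≈⟨ ℚᵘP.-‿cong (toℚᵘ-ℤ→ℚ a) ⟨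
  ℚᵘ.- toℚᵘ (ℤ→ℚ a)        ≈⟨ ℚP.toℚᵘ-homo‿- (ℤ→ℚ a) ⟨
  toℚᵘ (- ℤ→ℚ a)           ∎)
  where open ℚᵘP.≃-Reasoning

ℤ→ℚ-injective : ∀ {a b} → ℤ→ℚ a ≡ ℤ→ℚ b → a ≡ b
ℤ→ℚ-injective {a} {b} eq
  with ℚᵘP.≃-trans (ℚᵘP.≃-sym (toℚᵘ-ℤ→ℚ a)) (ℚᵘP.≃-trans (ℚP.toℚᵘ-cong eq) (toℚᵘ-ℤ→ℚ b))
... | ℚᵘ.*≡* a*1≡b*1 = trans (sym (ℤP.*-identityʳ a)) (trans a*1≡b*1 (ℤP.*-identityʳ b))

ℤ→ℚ-sumℤ : ∀ {m} (z : Fin m → ℤ) → ℤ→ℚ (sumℤ z) ≡ sumℚ (ℤ→ℚ ∘ z)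
ℤ→ℚ-sumℤ {zero}  z = refl
ℤ→ℚ-sumℤ {suc m} z = trans (ℤ→ℚ-+ (z zero) (sumℤ (z ∘ suc))) (cong (ℤ→ℚ (z zero) +_) (ℤ→ℚ-sumℤ (z ∘ suc)))

ℕ→ℚ-+ : ∀ a b → ℕ→ℚ (a ℕ.+ b) ≡ ℕ→ℚ a + ℕ→ℚ b
ℕ→ℚ-+ a b = trans (cong ℤ→ℚ (sym (ℤP.pos-+ a b))) (ℤ→ℚ-+ (ℤ.+ a) (ℤ.+ b))

recip : ℕ → ℚ
recip n = ℤ.+ 1 / suc n

ℤ→ℚ-*-recip : ∀ i n → ℤ→ℚ i * recip n ≡ i / suc n
ℤ→ℚ-*-recip i n = ℚP.toℚᵘ-injective (begin
  toℚᵘ (ℤ→ℚ i * recip n)                  ≈⟨ ℚP.toℚᵘ-homo-* (ℤ→ℚ i) (recip n) ⟩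
  toℚᵘ (ℤ→ℚ i) ℚᵘ.* toℚᵘ (recip n)
    ≈⟨ ℚᵘP.*-cong (toℚᵘ-ℤ→ℚ i) (ℚP.toℚᵘ-fromℚᵘ (ℚᵘ.mkℚᵘ (ℤ.+ 1) n)) ⟩
  ℚᵘ.mkℚᵘ i 0 ℚᵘ.* ℚᵘ.mkℚᵘ (ℤ.+ 1) n
    ≈⟨ ℚᵘ.*≡* (cong₂ (λ a m → a ℤ.* ℤ.+ m) (ℤP.*-identityʳ i) (sym (ℕP.*-identityˡ (suc n)))) ⟩
  ℚᵘ.mkℚᵘ i n                              ≈⟨ ℚP.toℚᵘ-fromℚᵘ (ℚᵘ.mkℚᵘ i n) ⟨
  toℚᵘ (i / suc n)                         ∎)
  where open ℚᵘP.≃-Reasoning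

ℕ→ℚ-*-recip : ∀ n → ℕ→ℚ (suc n) * recip n ≡ 1ℚ
ℕ→ℚ-*-recip n = trans (ℤ→ℚ-*-recip (ℤ.+ suc n) n) (ℚP.toℚᵘ-injective (begin
  toℚᵘ (ℤ.+ suc n / suc n)     ≈⟨ ℚP.toℚᵘ-fromℚᵘ (ℚᵘ.mkℚᵘ (ℤ.+ suc n) n) ⟩
  ℚᵘ.mkℚᵘ (ℤ.+ suc n) n         ≈⟨ ℚᵘ.*≡* (ℤP.*-comm (ℤ.+ suc n) (ℤ.+ 1)) ⟩
  toℚᵘ 1ℚ                      ∎))
  where open ℚᵘP.≃-Reasoning

ℕ→ℚ-if : ∀ b m → ℕ→ℚ (if b then m else 0) ≡ ℕ→ℚ m * (if b then 1ℚ else 0ℚ)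
ℕ→ℚ-if true  m = sym (ℚP.*-identityʳ (ℕ→ℚ m))
ℕ→ℚ-if false m = sym (ℚP.*-zeroʳ (ℕ→ℚ m))

sub-from-+ : ∀ {x y z : ℚ} → x + y ≡ z → x ≡ z - y
sub-from-+ {x} {y} {z} x+y≡z = trans (solve 2 (λ x y → x := (x :+ y) :- y) refl x y) (cong (_- y) x+y≡z)

module _ {n : ℕ} where

  inner-cong : {a a′ b b′ : Vector ℚ (suc n)} →
               (∀ k → a k ≡ a′ k) → (∀ k → b k ≡ b′ k) → inner a b ≡ inner a′ b′
  inner-cong a≗a′ b≗b′ = sumℚ-cong (λ k → cong₂ _*_ (a≗a′ k) (b≗b′ k))

  inner-comm : (a b : Vector ℚ (suc n)) → inner a b ≡ inner b a
  inner-comm a b = sumℚ-cong (λ k → ℚP.*-comm (a k) (b k))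

  inner-+ˡ : (a b c : Vector ℚ (suc n)) → inner (λ k → a k + b k) c ≡ inner a c + inner b c
  inner-+ˡ a b c = trans (sumℚ-cong (λ k → ℚP.*-distribʳ-+ (c k) (a k) (b k))) (sumℚ-+ (λ k → a k * c k) (λ k → b k * c k))

  inner-+ʳ : (a b c : Vector ℚ (suc n)) → inner c (λ k → a k + b k) ≡ inner c a + inner c b
  inner-+ʳ a b c = trans (sumℚ-cong (λ k → ℚP.*-distribˡ-+ (c k) (a k) (b k))) (sumℚ-+ (λ k → c k * a k) (λ k → c k * b k))

  inner-*ˡ : (s : ℚ) (a b : Vector ℚ (suc n)) → inner (λ k → s * a k) b ≡ s * inner a b
  inner-*ˡ s a b = trans (sumℚ-cong (λ k → ℚP.*-assoc s (a k) (b k))) (sumℚ-*ˡ s (λ k → a k * b k))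

  inner-zeroˡ : (b : Vector ℚ (suc n)) → inner (λ _ → 0ℚ) b ≡ 0ℚ
  inner-zeroˡ b = trans (sumℚ-cong (λ k → ℚP.*-zeroˡ (b k))) (sumℚ-zero (suc n))

  inner-permute : (π : Permutation′ (suc n)) (a b : Vector ℚ (suc n)) →
                  inner (a ∘ (π ⟨$⟩ʳ_)) (b ∘ (π ⟨$⟩ʳ_)) ≡ inner a b
  inner-permute π a b = sumℚ-permute π (λ k → a k * b k)

  inner-square-+ : (a b : Vector ℚ (suc n)) →
    inner (λ k → a k + b k) (λ k → a k + b k) ≡ inner a a + (inner a b + inner a b) + inner b b
  inner-square-+ a b = begin
    inner (λ k → a k + b k) (λ k → a k + b k)
      ≡⟨ inner-+ˡ a b (λ k → a k + b k) ⟩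
    inner a (λ k → a k + b k) + inner b (λ k → a k + b k)
      ≡⟨ cong₂ _+_ (trans (inner-comm a (λ k → a k + b k)) (inner-+ˡ a b a))
                   (trans (inner-comm b (λ k → a k + b k)) (inner-+ˡ a b b)) ⟩
    (inner a a + inner b a) + (inner a b + inner b b)
      ≡⟨ cong (λ z → (inner a a + z) + (inner a b + inner b b)) (inner-comm b a) ⟩
    (inner a a + inner a b) + (inner a b + inner b b)
      ≡⟨ solve 3 (λ x y z → (x :+ y) :+ (y :+ z) := x :+ (y :+ y) :+ z) refl (inner a a) (inner a b) (inner b b) ⟩
    inner a a + (inner a b + inner a b) + inner b b ∎
    where open ≡-Reasoning

  inner-negʳ : (a b : Vector ℚ (suc n)) → inner a (λ k → - b k) ≡ - inner a b
  inner-negʳ a b = trans (sumℚ-cong (λ k → sym (ℚP.neg-distribʳ-* (a k) (b k)))) (sumℚ-neg (λ k → a k * b k))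

  inner-neg-neg : (b : Vector ℚ (suc n)) → inner (λ k → - b k) (λ k → - b k) ≡ inner b b
  inner-neg-neg b = sumℚ-cong (λ k → solve 1 (λ x → :- x :* :- x := x :* x) refl (b k))

  ≈H-refl : {v : H n} → v ≈H v
  ≈H-refl = (λ _ → refl) , refl , refl

  ≈H-sym : {v w : H n} → v ≈H w → w ≈H v
  ≈H-sym (V≗ , d≡ , l≡) = (λ k → sym (V≗ k)) , sym d≡ , sym l≡

  ≈H-trans : {u v w : H n} → u ≈H v → v ≈H w → u ≈H w
  ≈H-trans (V≗ , d≡ , l≡) (V≗′ , d≡′ , l≡′) = (λ k → trans (V≗ k) (V≗′ k)) , trans d≡ d≡′ , trans l≡ l≡′

  ≈H-setoid : Setoid 0ℓ 0ℓ
  ≈H-setoid = record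
    { Carrier = H n
    ; _≈_ = _≈H_
    ; isEquivalence = record { refl = ≈H-refl ; sym = ≈H-sym ; trans = ≈H-trans }
    }

  t-cong : {x x′ : Vector ℚ (suc n)} {v v′ : H n} → (∀ k → x k ≡ x′ k) → v ≈H v′ → t x v ≈H t x′ v′
  t-cong x≗x′ (V≗ , d≡ , l≡) =
    (λ k → cong₂ _+_ (V≗ k) (cong₂ _*_ l≡ (x≗x′ k))) ,
    cong₂ _-_ d≡ (cong₂ _+_ (inner-cong V≗ x≗x′) (cong₂ _*_ (cong (½ *_) (inner-cong x≗x′ x≗x′)) l≡)) ,
    l≡

  t-congʳ : (x : Vector ℚ (suc n)) {v v′ : H n} → v ≈H v′ → t x v ≈H t x v′
  t-congʳ x = t-cong {x = x} (λ _ → refl)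

  permActInv-cong : {f f′ : Fin (suc n) → Fin (suc n)} {v v′ : H n} →
                    (∀ k → f k ≡ f′ k) → v ≈H v′ → permActInv f v ≈H permActInv f′ v′
  permActInv-cong {v′ = v′} f≗f′ (V≗ , d≡ , l≡) = (λ k → trans (V≗ _) (cong (V v′) (f≗f′ k))) , d≡ , l≡

  permActInv-congʳ : (f : Fin (suc n) → Fin (suc n)) {v v′ : H n} → v ≈H v′ → permActInv f v ≈H permActInv f v′
  permActInv-congʳ f = permActInv-cong {f = f} (λ _ → refl)

  t-zero : (v : H n) → t (λ _ → 0ℚ) v ≈H v
  t-zero v =
    (λ k → trans (cong (V v k +_) (ℚP.*-zeroʳ (l v))) (ℚP.+-identityʳ (V v k))) ,
    trans (cong₂ (λ a b → d v - (a + ½ * b * l v))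
                 (trans (inner-comm (V v) (λ _ → 0ℚ)) (inner-zeroˡ (V v))) (inner-zeroˡ (λ _ → 0ℚ)))
          (solve 2 (λ D L → D :- (con 0ℚ :+ con ½ :* con 0ℚ :* L) := D) refl (d v) (l v)) ,
    refl

  t-t : (x y : Vector ℚ (suc n)) (v : H n) → t x (t y v) ≈H t (λ k → y k + x k) v
  t-t x y v = (λ k → solve 4 (λ a L b c → (a :+ L :* b) :+ L :* c := a :+ L :* (b :+ c)) refl (V v k) (l v) (y k) (x k)) ,
              d-part , refl
    where
    open ≡-Reasoning
    L = l v
    d-part : (d v - (inner (V v) y + ½ * inner y y * L)) - (inner (λ k → V v k + L * y k) x + ½ * inner x x * L)
           ≡ d v - (inner (V v) (λ k → y k + x k) + ½ * inner (λ k → y k + x k) (λ k → y k + x k) * L)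
    d-part = begin
      (d v - (inner (V v) y + ½ * inner y y * L)) - (inner (λ k → V v k + L * y k) x + ½ * inner x x * L)
        ≡⟨ cong (λ z → (d v - (inner (V v) y + ½ * inner y y * L)) - (z + ½ * inner x x * L))
                (trans (inner-+ˡ (V v) (λ k → L * y k) x) (cong (inner (V v) x +_) (inner-*ˡ L y x))) ⟩
      (d v - (inner (V v) y + ½ * inner y y * L)) - ((inner (V v) x + L * inner y x) + ½ * inner x x * L)
        ≡⟨ solve 7 (λ D Vy Vx yy yx xx L →
                    (D :- (Vy :+ con ½ :* yy :* L)) :- ((Vx :+ L :* yx) :+ con ½ :* xx :* L)
                 := D :- ((Vy :+ Vx) :+ con ½ :* (yy :+ (yx :+ yx) :+ xx) :* L))
                refl (d v) (inner (V v) y) (inner (V v) x) (inner y y) (inner y x) (inner x x) L ⟩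
      d v - ((inner (V v) y + inner (V v) x) + ½ * (inner y y + (inner y x + inner y x) + inner x x) * L)
        ≡⟨ cong₂ (λ a b → d v - (a + ½ * b * L)) (sym (inner-+ʳ y x (V v))) (sym (inner-square-+ y x)) ⟩
      d v - (inner (V v) (λ k → y k + x k) + ½ * inner (λ k → y k + x k) (λ k → y k + x k) * L) ∎

  permActInv-t : (π : Permutation′ (suc n)) (x : Vector ℚ (suc n)) (v : H n) →
    permActInv (π ⟨$⟩ʳ_) (t x v) ≈H t (x ∘ (π ⟨$⟩ʳ_)) (permActInv (π ⟨$⟩ʳ_) v)
  permActInv-t π x v =
    (λ _ → refl) ,
    cong (λ z → d v - z) (cong₂ (λ a b → a + ½ * b * l v) (sym (inner-permute π (V v) x)) (sym (inner-permute π x x))) ,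
    refl

  ht-cong : {v w : H n} → v ≈H w → ht v ≡ ht w
  ht-cong (V≗ , d≡ , _) =
    cong₂ _+_ (sumℚ-cong {n} (λ k → sumℚ-cong (λ i → cong (λ z → if toℕ i ≤ᵇ toℕ k then z else 0ℚ) (V≗ i))))
              (cong (ℤ→ℚ (ℤ.+ suc n) *_) d≡)

  -H-congʳ : (u : H n) {v w : H n} → v ≈H w → (u -H v) ≈H (u -H w)
  -H-congʳ u (V≗ , d≡ , l≡) = (λ k → cong (λ z → V u k - z) (V≗ k)) , cong (λ z → d u - z) d≡ , cong (λ z → l u - z) l≡

  tΛ₀ : Vector ℚ (suc n) → H n
  tΛ₀ y = mkH y (- (½ * inner y y)) 1ℚ

  t-Λ₀ : (y : Vector ℚ (suc n)) → t y Λ₀ ≈H tΛ₀ y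
  t-Λ₀ y =
    (λ k → trans (ℚP.+-identityˡ (1ℚ * y k)) (ℚP.*-identityˡ (y k))) ,
    trans (cong (λ z → 0ℚ - (z + ½ * inner y y * 1ℚ)) (inner-zeroˡ y))
          (solve 1 (λ s → con 0ℚ :- (con 0ℚ :+ con ½ :* s :* con 1ℚ) := :- (con ½ :* s)) refl (inner y y)) ,
    refl

  t-tΛ₀ : (x y : Vector ℚ (suc n)) → t x (tΛ₀ y) ≈H tΛ₀ (λ k → y k + x k)
  t-tΛ₀ x y = ≈H-trans (t-congʳ x (≈H-sym (t-Λ₀ y))) (≈H-trans (t-t x y Λ₀) (t-Λ₀ (λ k → y k + x k)))

  permActInv-tΛ₀ : (π : Permutation′ (suc n)) (y : Vector ℚ (suc n)) →
                   permActInv (π ⟨$⟩ʳ_) (tΛ₀ y) ≈H tΛ₀ (y ∘ (π ⟨$⟩ʳ_))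
  permActInv-tΛ₀ π y =
    ≈H-trans (permActInv-congʳ (π ⟨$⟩ʳ_) (≈H-sym (t-Λ₀ y)))
             (≈H-trans (permActInv-t π y Λ₀) (t-Λ₀ (y ∘ (π ⟨$⟩ʳ_))))

sumℚ-if-≤ᵇ : ∀ m a (c : ℚ) → sumℚ {m} (λ k → if a ≤ᵇ toℕ k then c else 0ℚ) ≡ ℕ→ℚ (m ∸ a) * c
sumℚ-if-≤ᵇ zero    a       c = trans (sym (ℚP.*-zeroˡ c)) (cong (λ z → ℕ→ℚ z * c) (sym (ℕP.0∸n≡0 a)))
sumℚ-if-≤ᵇ (suc m) zero    c = begin
  c + sumℚ {m} (λ _ → c)   ≡⟨ cong (c +_) (sumℚ-if-≤ᵇ m zero c) ⟩
  c + ℕ→ℚ m * c             ≡⟨ solve 2 (λ c x → c :+ x :* c := (con 1ℚ :+ x) :* c) refl c (ℕ→ℚ m) ⟩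
  (1ℚ + ℕ→ℚ m) * c          ≡⟨ cong (_* c) (sym (ℕ→ℚ-+ 1 m)) ⟩
  ℕ→ℚ (suc m) * c           ∎
  where open ≡-Reasoning
sumℚ-if-≤ᵇ (suc m) (suc a) c =
  trans (ℚP.+-identityˡ _)
        (trans (sumℚ-cong {m} (λ k → cong (λ b → if b then c else 0ℚ) (≤ᵇ-suc a (toℕ k)))) (sumℚ-if-≤ᵇ m a c))
  where
  ≤ᵇ-suc : ∀ a x → (suc a ≤ᵇ suc x) ≡ (a ≤ᵇ x)
  ≤ᵇ-suc zero    x = refl
  ≤ᵇ-suc (suc a) x = refl

sumℚ-αcoef : ∀ {n} (x : Vector ℚ (suc n)) → sumℚ (αcoef x) ≡ sumℚ (λ i → ℕ→ℚ (n ∸ toℕ i) * x i)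
sumℚ-αcoef {n} x =
  trans (sumℚ-comm {n} (λ k i → if toℕ i ≤ᵇ toℕ k then x i else 0ℚ)) (sumℚ-cong (λ i → sumℚ-if-≤ᵇ n (toℕ i) (x i)))

ht-Λ₀-tΛ₀ : ∀ {n} (y : Vector ℚ (suc n)) →
  ht (Λ₀ -H tΛ₀ y) ≡ ℕ→ℚ (suc n) * (½ * inner y y) - sumℚ (λ i → ℕ→ℚ (n ∸ toℕ i) * y i)
ht-Λ₀-tΛ₀ {n} y = begin
  sumℚ (αcoef (λ k → 0ℚ - y k)) + N * (0ℚ - - (½ * inner y y))
    ≡⟨ cong₂ _+_ (sumℚ-αcoef (λ k → 0ℚ - y k)) (cong (N *_) (solve 1 (λ s → con 0ℚ :- :- s := s) refl (½ * inner y y))) ⟩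
  sumℚ (λ i → a i * (0ℚ - y i)) + N * (½ * inner y y)
    ≡⟨ cong (_+ N * (½ * inner y y)) (trans (sumℚ-cong λ i → solve 2 (λ a y → a :* (con 0ℚ :- y) := :- (a :* y)) refl (a i) (y i))
                                            (sumℚ-neg (λ i → a i * y i))) ⟩
  - sumℚ (λ i → a i * y i) + N * (½ * inner y y)
    ≡⟨ ℚP.+-comm (- sumℚ (λ i → a i * y i)) (N * (½ * inner y y)) ⟩
  N * (½ * inner y y) - sumℚ (λ i → a i * y i) ∎
  where
  open ≡-Reasoning
  N = ℕ→ℚ (suc n)
  a : Vector ℚ (suc n)
  a i = ℕ→ℚ (n ∸ toℕ i)

blockReverse : ℕ → ℕ → ℕ → ℕ
blockReverse n j a = if a <ᵇ j then j ∸ 1 ∸ a else n ℕ.+ j ∸ a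

blockReverse-< : ∀ {n j a} → a < j → blockReverse n j a ≡ j ∸ 1 ∸ a
blockReverse-< {j = j} {a} a<j with a <ᵇ j | ℕP.<ᵇ-reflects-< a j
... | true  | _        = refl
... | false | ofⁿ a≮j = ⊥-elim (a≮j a<j)

blockReverse-≥ : ∀ {n j a} → j ≤ a → blockReverse n j a ≡ n ℕ.+ j ∸ a
blockReverse-≥ {j = j} {a} j≤a with a <ᵇ j | ℕP.<ᵇ-reflects-< a j
... | true  | ofʸ a<j = ⊥-elim (ℕP.<⇒≱ a<j j≤a)
... | false | _        = refl

module _ {n j a : ℕ} where

  blockReverse-≤ : j ≤ suc n → a ≤ n → blockReverse n j a ≤ n
  blockReverse-≤ j≤1+n a≤n with a <? j
  ... | yes a<j@(s≤s _) = begin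
    blockReverse n j a ≡⟨ blockReverse-< a<j ⟩
    j ∸ 1 ∸ a          ≤⟨ ℕP.m∸n≤m (j ∸ 1) a ⟩
    j ∸ 1              ≤⟨ ℕP.∸-monoˡ-≤ 1 j≤1+n ⟩
    n                  ∎
    where open ℕP.≤-Reasoning
  ... | no a≮j = begin
    blockReverse n j a ≡⟨ blockReverse-≥ (ℕP.≮⇒≥ a≮j) ⟩
    n ℕ.+ j ∸ a        ≤⟨ ℕP.∸-monoˡ-≤ a (ℕP.+-monoʳ-≤ n (ℕP.≮⇒≥ a≮j)) ⟩
    n ℕ.+ a ∸ a        ≡⟨ ℕP.m+n∸n≡m n a ⟩
    n                  ∎
    where open ℕP.≤-Reasoning

  blockReverse-involutive : j ≤ suc n → a ≤ n → blockReverse n j (blockReverse n j a) ≡ a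
  blockReverse-involutive j≤1+n a≤n with a <? j
  ... | yes a<j@(s≤s a≤j-1) = begin
    blockReverse n j (blockReverse n j a) ≡⟨ cong (blockReverse n j) (blockReverse-< a<j) ⟩
    blockReverse n j (j ∸ 1 ∸ a)          ≡⟨ blockReverse-< (s≤s (ℕP.m∸n≤m (j ∸ 1) a)) ⟩
    j ∸ 1 ∸ (j ∸ 1 ∸ a)                   ≡⟨ ℕP.m∸[m∸n]≡n a≤j-1 ⟩
    a                                     ∎
    where open ≡-Reasoning
  ... | no a≮j = begin
    blockReverse n j (blockReverse n j a) ≡⟨ cong (blockReverse n j) (trans (blockReverse-≥ j≤a) n+j∸a≡n∸a+j) ⟩
    blockReverse n j ((n ∸ a) ℕ.+ j)      ≡⟨ blockReverse-≥ (ℕP.m≤n+m j (n ∸ a)) ⟩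
    n ℕ.+ j ∸ ((n ∸ a) ℕ.+ j)             ≡⟨ cong₂ _∸_ (ℕP.+-comm n j) (ℕP.+-comm (n ∸ a) j) ⟩
    j ℕ.+ n ∸ (j ℕ.+ (n ∸ a))             ≡⟨ ℕP.[m+n]∸[m+o]≡n∸o j n (n ∸ a) ⟩
    n ∸ (n ∸ a)                           ≡⟨ ℕP.m∸[m∸n]≡n a≤n ⟩
    a                                     ∎
    where
    open ≡-Reasoning
    j≤a = ℕP.≮⇒≥ a≮j
    n+j∸a≡n∸a+j = ℕP.+-∸-comm j a≤n

  blockReverse-shift : a ≤ n → blockReverse n j a ℕ.+ (if a <ᵇ j then suc n else 0) ≡ (n ∸ a) ℕ.+ j
  blockReverse-shift a≤n with a <ᵇ j | ℕP.<ᵇ-reflects-< a j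
  ... | true | ofʸ (s≤s {n = j-1} a≤j-1) = begin
    (j-1 ∸ a) ℕ.+ suc n          ≡⟨ ℕP.+-∸-comm (suc n) a≤j-1 ⟨
    j-1 ℕ.+ suc n ∸ a            ≡⟨ cong (_∸ a) (ℕP.+-comm j-1 (suc n)) ⟩
    suc n ℕ.+ j-1 ∸ a            ≡⟨ cong (_∸ a) (ℕP.+-suc n j-1) ⟨
    n ℕ.+ j ∸ a                  ≡⟨ ℕP.+-∸-comm j a≤n ⟩
    (n ∸ a) ℕ.+ j                ∎
    where open ≡-Reasoning
  ... | false | _ = begin
    n ℕ.+ j ∸ a ℕ.+ 0        ≡⟨ ℕP.+-identityʳ (n ℕ.+ j ∸ a) ⟩
    n ℕ.+ j ∸ a              ≡⟨ ℕP.+-∸-comm j a≤n ⟩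
    (n ∸ a) ℕ.+ j            ∎
    where open ≡-Reasoning

toℕ-toFin : ∀ m k → k ≤ m → toℕ (toFin m k) ≡ k
toℕ-toFin m k k≤m with k <? suc m
... | yes k<1+m = FinP.toℕ-fromℕ< k<1+m
... | no  k≮1+m = ⊥-elim (k≮1+m (s≤s k≤m))

module BlockReversal {n j : ℕ} (j≤1+n : j ≤ suc n) where

  toℕ-w₀j : (i : Fin (suc n)) → toℕ (w₀j {n} j i) ≡ blockReverse n j (toℕ i)
  toℕ-w₀j i = toℕ-toFin n _ (blockReverse-≤ j≤1+n (FinP.toℕ≤pred[n] i))

  w₀j-involutive : (i : Fin (suc n)) → w₀j j (w₀j j i) ≡ i
  w₀j-involutive i = FinP.toℕ-injective (begin
    toℕ (w₀j j (w₀j j i))                         ≡⟨ toℕ-w₀j (w₀j j i) ⟩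
    blockReverse n j (toℕ (w₀j j i))              ≡⟨ cong (blockReverse n j) (toℕ-w₀j i) ⟩
    blockReverse n j (blockReverse n j (toℕ i))   ≡⟨ blockReverse-involutive j≤1+n (FinP.toℕ≤pred[n] i) ⟩
    toℕ i                                         ∎)
    where open ≡-Reasoning

  blockReversal : Permutation′ (suc n)
  blockReversal = permutation (w₀j j) (w₀j j) w₀j-involutive w₀j-involutive

  w₀∘w₀j : Permutation′ (suc n)
  w₀∘w₀j = blockReversal ∘ₚ reverse

  n∸w₀∘w₀j : (i : Fin (suc n)) →
    n ∸ toℕ (w₀∘w₀j ⟨$⟩ʳ i) ℕ.+ (if toℕ i <ᵇ j then suc n else 0) ≡ (n ∸ toℕ i) ℕ.+ j
  n∸w₀∘w₀j i = begin
    n ∸ toℕ (w₀ (w₀j j i)) ℕ.+ s           ≡⟨ cong (λ z → n ∸ z ℕ.+ s) (FinP.opposite-prop (w₀j j i)) ⟩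
    n ∸ (n ∸ toℕ (w₀j j i)) ℕ.+ s          ≡⟨ cong (ℕ._+ s) (ℕP.m∸[m∸n]≡n (FinP.toℕ≤pred[n] (w₀j j i))) ⟩
    toℕ (w₀j j i) ℕ.+ s                    ≡⟨ cong (ℕ._+ s) (toℕ-w₀j i) ⟩
    blockReverse n j (toℕ i) ℕ.+ s         ≡⟨ blockReverse-shift (FinP.toℕ≤pred[n] i) ⟩
    (n ∸ toℕ i) ℕ.+ j                      ∎
    where
    open ≡-Reasoning
    s = if toℕ i <ᵇ j then suc n else 0

-- ρ/h up to a multiple of (1, …, 1)
centre : (n : ℕ) → Vector ℚ (suc n)
centre n i = ℕ→ℚ (n ∸ toℕ i) * recip n

dist² : ∀ {n} → Vector ℚ (suc n) → ℚ
dist² {n} y = inner (λ i → y i - centre n i) (λ i → y i - centre n i)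

ht-Λ₀-tΛ₀≡dist² : ∀ {n} (y : Vector ℚ (suc n)) →
  ht (Λ₀ -H tΛ₀ y) ≡ ℕ→ℚ (suc n) * (½ * (dist² y - inner (centre n) (centre n)))
ht-Λ₀-tΛ₀≡dist² {n} y = begin
  ht (Λ₀ -H tΛ₀ y)                                    ≡⟨ ht-Λ₀-tΛ₀ y ⟩
  N * (½ * inner y y) - sumℚ (λ i → a i * y i)        ≡⟨ cong (λ z → N * (½ * inner y y) - z) weighted-sum ⟩
  N * (½ * inner y y) - N * inner y c                 ≡⟨ solve 4 (λ N Y X C → N :* (con ½ :* Y) :- N :* X
                                                                := N :* (con ½ :* ((Y :+ (:- X :+ :- X) :+ C) :- C)))
                                                               refl N (inner y y) (inner y c) (inner c c) ⟩
  N * (½ * ((inner y y + (- inner y c + - inner y c) + inner c c) - inner c c))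
    ≡⟨ cong (λ z → N * (½ * (z - inner c c))) (sym dist²-expand) ⟩
  N * (½ * (dist² y - inner c c))                     ∎
  where
  open ≡-Reasoning
  N = ℕ→ℚ (suc n)
  c = centre n
  a : Vector ℚ (suc n)
  a i = ℕ→ℚ (n ∸ toℕ i)
  weighted-sum : sumℚ (λ i → a i * y i) ≡ N * inner y c
  weighted-sum = sym (trans (sym (sumℚ-*ˡ N (λ i → y i * c i))) (sumℚ-cong λ i → begin
    N * (y i * (a i * recip n))   ≡⟨ solve 4 (λ N y a r → N :* (y :* (a :* r)) := a :* y :* (N :* r)) refl N (y i) (a i) (recip n) ⟩
    a i * y i * (N * recip n)     ≡⟨ cong (a i * y i *_) (ℕ→ℚ-*-recip n) ⟩
    a i * y i * 1ℚ                ≡⟨ ℚP.*-identityʳ (a i * y i) ⟩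
    a i * y i                     ∎))
  dist²-expand : dist² y ≡ inner y y + (- inner y c + - inner y c) + inner c c
  dist²-expand = begin
    dist² y                                                          ≡⟨ inner-square-+ y (λ i → - c i) ⟩
    inner y y + (inner y (λ i → - c i) + inner y (λ i → - c i)) + inner (λ i → - c i) (λ i → - c i)
      ≡⟨ cong₂ (λ u v → inner y y + (u + u) + v) (inner-negʳ y c) (inner-neg-neg c) ⟩
    inner y y + (- inner y c + - inner y c) + inner c c             ∎

htΛ₀-cong : ∀ {n} {v w : H n} → v ≈H w → ht (Λ₀ -H v) ≡ ht (Λ₀ -H w)
htΛ₀-cong v≈w = ht-cong (-H-congʳ Λ₀ v≈w)

InΛ₀Orbit : ∀ {n} → H n → Set
InΛ₀Orbit {n} v = Σ (Vector ℚ (suc n)) (λ y → v ≈H tΛ₀ y)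

module Sigma {n j : ℕ} (j≤1+n : j ≤ suc n) where

  open BlockReversal j≤1+n

  centre-w₀∘w₀j : (i : Fin (suc n)) → centre n (w₀∘w₀j ⟨$⟩ʳ i) ≡ centre n i - ω n j i
  centre-w₀∘w₀j i = begin
    B * ι                             ≡⟨ cong (_* ι) B≡A+J-N*E ⟩
    ((A + J) - N * E) * ι             ≡⟨ solve 5 (λ A J N E ι → ((A :+ J) :- N :* E) :* ι
                                                  := A :* ι :- (E :- J :* ι) :+ E :* (con 1ℚ :- N :* ι))
                                               refl A J N E ι ⟩
    A * ι - (E - J * ι) + E * (1ℚ - N * ι) ≡⟨ cong (λ z → A * ι - (E - J * ι) + E * (1ℚ - z)) (ℕ→ℚ-*-recip n) ⟩
    A * ι - (E - J * ι) + E * (1ℚ - 1ℚ)    ≡⟨ solve 4 (λ A J E ι → A :* ι :- (E :- J :* ι) :+ E :* (con 1ℚ :- con 1ℚ)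
                                                       := A :* ι :- (E :- J :* ι))
                                                    refl A J E ι ⟩
    A * ι - (E - J * ι)               ≡⟨ cong (λ z → A * ι - (E - z)) (ℤ→ℚ-*-recip (ℤ.+ j) n) ⟩
    A * ι - ω n j i                   ∎
    where
    open ≡-Reasoning
    ι = recip n
    N = ℕ→ℚ (suc n)
    J = ℕ→ℚ j
    A = ℕ→ℚ (n ∸ toℕ i)
    B = ℕ→ℚ (n ∸ toℕ (w₀∘w₀j ⟨$⟩ʳ i))
    E = if toℕ i <ᵇ j then 1ℚ else 0ℚ
    B≡A+J-N*E : B ≡ (A + J) - N * E
    B≡A+J-N*E = sub-from-+ (begin
      B + N * E                                                ≡⟨ cong (B +_) (sym (ℕ→ℚ-if (toℕ i <ᵇ j) (suc n))) ⟩
      B + ℕ→ℚ (if toℕ i <ᵇ j then suc n else 0)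
        ≡⟨ sym (ℕ→ℚ-+ (n ∸ toℕ (w₀∘w₀j ⟨$⟩ʳ i)) (if toℕ i <ᵇ j then suc n else 0)) ⟩
      ℕ→ℚ (n ∸ toℕ (w₀∘w₀j ⟨$⟩ʳ i) ℕ.+ (if toℕ i <ᵇ j then suc n else 0))
        ≡⟨ cong ℕ→ℚ (n∸w₀∘w₀j i) ⟩
      ℕ→ℚ ((n ∸ toℕ i) ℕ.+ j)                                  ≡⟨ ℕ→ℚ-+ (n ∸ toℕ i) j ⟩
      A + J                                                    ∎)

  dist²-σ : (y : Vector ℚ (suc n)) → dist² (λ i → y (w₀∘w₀j ⟨$⟩ʳ i) + ω n j i) ≡ dist² y
  dist²-σ y = trans (inner-cong shifted shifted) (inner-permute w₀∘w₀j y-c y-c)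
    where
    y-c : Vector ℚ (suc n)
    y-c i = y i - centre n i
    shifted : ∀ i → y (w₀∘w₀j ⟨$⟩ʳ i) + ω n j i - centre n i ≡ y-c (w₀∘w₀j ⟨$⟩ʳ i)
    shifted i = trans (solve 3 (λ y w c → y :+ w :- c := y :- (c :- w)) refl (y (w₀∘w₀j ⟨$⟩ʳ i)) (ω n j i) (centre n i))
                      (cong (λ z → y (w₀∘w₀j ⟨$⟩ʳ i) - z) (sym (centre-w₀∘w₀j i)))

  σ-cong : {v w : H n} → v ≈H w → σ n j v ≈H σ n j w
  σ-cong v≈w = t-congʳ (ω n j) (permActInv-congʳ (w₀ ∘ w₀j j) v≈w)

  σ-tΛ₀ : (y : Vector ℚ (suc n)) → σ n j (tΛ₀ y) ≈H tΛ₀ (λ i → y (w₀∘w₀j ⟨$⟩ʳ i) + ω n j i)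
  σ-tΛ₀ y = ≈H-trans (t-congʳ (ω n j) (permActInv-tΛ₀ w₀∘w₀j y)) (t-tΛ₀ (ω n j) (y ∘ (w₀∘w₀j ⟨$⟩ʳ_)))

  σ-InΛ₀Orbit : {v : H n} → InΛ₀Orbit v → InΛ₀Orbit (σ n j v)
  σ-InΛ₀Orbit (y , v≈y) = _ , ≈H-trans (σ-cong v≈y) (σ-tΛ₀ y)

  htΛ₀-σ : {v : H n} → InΛ₀Orbit v → ht (Λ₀ -H σ n j v) ≡ ht (Λ₀ -H v)
  htΛ₀-σ {v} (y , v≈y) = begin
    ht (Λ₀ -H σ n j v)         ≡⟨ htΛ₀-cong (≈H-trans (σ-cong v≈y) (σ-tΛ₀ y)) ⟩
    ht (Λ₀ -H tΛ₀ y′)          ≡⟨ ht-Λ₀-tΛ₀≡dist² y′ ⟩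
    N * (½ * (dist² y′ - C))   ≡⟨ cong (λ z → N * (½ * (z - C))) (dist²-σ y) ⟩
    N * (½ * (dist² y - C))    ≡⟨ ht-Λ₀-tΛ₀≡dist² y ⟨
    ht (Λ₀ -H tΛ₀ y)           ≡⟨ htΛ₀-cong v≈y ⟨
    ht (Λ₀ -H v)               ∎
    where
    open ≡-Reasoning
    N = ℕ→ℚ (suc n)
    C = inner (centre n) (centre n)
    y′ : Vector ℚ (suc n)
    y′ i = y (w₀∘w₀j ⟨$⟩ʳ i) + ω n j i

  σ-σinv : (v : H n) → σ n j (σinv n j v) ≈H v
  σ-σinv v = begin
    t (ω n j) (permActInv (w₀ ∘ w₀j j) (permActInv (w₀j j ∘ w₀) (t -ω v)))
      ≈⟨ t-congʳ (ω n j) (permActInv-cong {f = w₀j j ∘ w₀ ∘ w₀ ∘ w₀j j} {v = t -ω v}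
                                          (λ _ → inverseˡ w₀∘w₀j) ≈H-refl) ⟩
    t (ω n j) (t -ω v)                     ≈⟨ t-t (ω n j) -ω v ⟩
    t (λ k → - ω n j k + ω n j k) v        ≈⟨ t-cong {v = v} (λ k → ℚP.+-inverseˡ (ω n j k)) ≈H-refl ⟩
    t (λ _ → 0ℚ) v                         ≈⟨ t-zero v ⟩
    v                                      ∎
    where
    open import Relation.Binary.Reasoning.Setoid ≈H-setoid
    -ω : Vector ℚ (suc n)
    -ω k = - ω n j k

module _ {A B : Set} {P : A → Set} {f : A → A} (f-preserves : ∀ {x} → P x → P (f x)) where

  iter-preserves : ∀ k {x} → P x → P (iter f k x)
  iter-preserves zero    Px = Px
  iter-preserves (suc k) Px = f-preserves (iter-preserves k Px)

  iter-invariant : (h : A → B) → (∀ {x} → P x → h (f x) ≡ h x) → ∀ k {x} → P x → h (iter f k x) ≡ h x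
  iter-invariant h h∘f≡h zero    Px = refl
  iter-invariant h h∘f≡h (suc k) Px = trans (h∘f≡h (iter-preserves k Px)) (iter-invariant h h∘f≡h k Px)

actW-InΛ₀Orbit : ∀ {n} (w : WElt n) → InΛ₀Orbit (actW w Λ₀)
actW-InΛ₀Orbit w = ℤ→ℚ ∘ q w , t-Λ₀ (ℤ→ℚ ∘ q w)

InΛ₀Orbit-resp : ∀ {n} {v w : H n} → v ≈H w → InΛ₀Orbit w → InΛ₀Orbit v
InΛ₀Orbit-resp v≈w (y , w≈y) = y , ≈H-trans v≈w w≈y

module Conjugation {n j : ℕ} (j≤1+n : j ≤ suc n) (w : WElt n) where

  open BlockReversal j≤1+n

  P Q U⁻¹ : Fin (suc n) → Fin (suc n)
  P   = w₀∘w₀j ⟨$⟩ʳ_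
  Q   = w₀∘w₀j ⟨$⟩ˡ_
  U⁻¹ = u w ⟨$⟩ˡ_

  q̂ : Vector ℚ (suc n)
  q̂ = ℤ→ℚ ∘ q w

  ind : Fin (suc n) → ℤ
  ind i = if toℕ i <ᵇ j then ℤ.+ 1 else ℤ.+ 0

  -- ω_j = ind − j/h, so ω_j ∘ u⁻¹ − ω_j = ind ∘ u⁻¹ − ind is integral.
  q′ : Fin (suc n) → ℤ
  q′ k = q w (Q k) ℤ.+ (ind (U⁻¹ (Q k)) ℤ.- ind (Q k))

  translation : Vector ℚ (suc n)
  translation k = (ω n j (U⁻¹ k) + q̂ k) + - ω n j k

  ℤ→ℚ-q′ : ∀ k → ℤ→ℚ (q′ k) ≡ translation (Q k)
  ℤ→ℚ-q′ k = begin
    ℤ→ℚ (q′ k)                                    ≡⟨ ℤ→ℚ-+ (q w (Q k)) _ ⟩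
    q̂ (Q k) + ℤ→ℚ (ind (U⁻¹ (Q k)) ℤ.- ind (Q k))
      ≡⟨ cong (q̂ (Q k) +_) (ℤ→ℚ-+ (ind (U⁻¹ (Q k))) (ℤ.- ind (Q k))) ⟩
    q̂ (Q k) + (e (U⁻¹ (Q k)) + ℤ→ℚ (ℤ.- ind (Q k)))
      ≡⟨ cong (λ z → q̂ (Q k) + (e (U⁻¹ (Q k)) + z)) (ℤ→ℚ-neg (ind (Q k))) ⟩
    q̂ (Q k) + (e (U⁻¹ (Q k)) + - e (Q k))         ≡⟨ solve 4 (λ q a b r → q :+ (a :+ :- b) := ((a :- r) :+ q) :+ :- (b :- r))
                                                              refl (q̂ (Q k)) (e (U⁻¹ (Q k))) (e (Q k)) (ℤ.+ j / suc n) ⟩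
    (ω′ (U⁻¹ (Q k)) + q̂ (Q k)) + - ω′ (Q k)
      ≡⟨ cong₂ (λ a b → (a + q̂ (Q k)) + - b) (ω≡ (U⁻¹ (Q k))) (ω≡ (Q k)) ⟩
    translation (Q k)                             ∎
    where
    open ≡-Reasoning
    e : Fin (suc n) → ℚ
    e i = ℤ→ℚ (ind i)
    ω′ : Fin (suc n) → ℚ
    ω′ i = e i - ℤ.+ j / suc n
    ω≡ : ∀ i → ω′ i ≡ ω n j i
    ω≡ i = cong (_- ℤ.+ j / suc n) (if-float ℤ→ℚ (toℕ i <ᵇ j))

  q′∈M : sumℤ q′ ≡ ℤ.+ 0
  q′∈M = ℤ→ℚ-injective (begin
    ℤ→ℚ (sumℤ q′)                                     ≡⟨ ℤ→ℚ-sumℤ q′ ⟩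
    sumℚ (ℤ→ℚ ∘ q′)                                   ≡⟨ sumℚ-cong ℤ→ℚ-q′ ⟩
    sumℚ (translation ∘ Q)                            ≡⟨ sumℚ-permute (flip w₀∘w₀j) translation ⟩
    sumℚ translation                                  ≡⟨ sumℚ-+ (λ k → ω n j (U⁻¹ k) + q̂ k) (λ k → - ω n j k) ⟩
    sumℚ (λ k → ω n j (U⁻¹ k) + q̂ k) + sumℚ (λ k → - ω n j k)
      ≡⟨ cong₂ _+_ (sumℚ-+ (ω n j ∘ U⁻¹) q̂) (sumℚ-neg (ω n j)) ⟩
    (sumℚ (ω n j ∘ U⁻¹) + sumℚ q̂) + - sumℚ (ω n j)
      ≡⟨ cong₂ (λ a b → (a + b) + - sumℚ (ω n j)) (sumℚ-permute (flip (u w)) (ω n j))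
                                                  (trans (sym (ℤ→ℚ-sumℤ (q w))) (cong ℤ→ℚ (q∈M w))) ⟩
    (sumℚ (ω n j) + 0ℚ) + - sumℚ (ω n j)
      ≡⟨ solve 1 (λ s → (s :+ con 0ℚ) :+ :- s := con 0ℚ) refl (sumℚ (ω n j)) ⟩
    0ℚ                                                ∎)
    where open ≡-Reasoning

  w′ : WElt n
  w′ = mkW q′ q′∈M (flip w₀∘w₀j ∘ₚ u w ∘ₚ w₀∘w₀j)

  πj-actW : (v : H n) → πj n j (actW w) v ≈H actW w′ v
  πj-actW v = begin
    permActInv Q (t -ω (t q̂ (permActInv U⁻¹ (t (ω n j) Z))))
      ≈⟨ permActInv-congʳ Q (t-congʳ -ω (t-congʳ q̂ (permActInv-t (flip (u w)) (ω n j) Z))) ⟩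
    permActInv Q (t -ω (t q̂ (t (ω n j ∘ U⁻¹) Z′)))
      ≈⟨ permActInv-congʳ Q (t-congʳ -ω (t-t q̂ (ω n j ∘ U⁻¹) Z′)) ⟩
    permActInv Q (t -ω (t (λ k → ω n j (U⁻¹ k) + q̂ k) Z′))
      ≈⟨ permActInv-congʳ Q (t-t -ω (λ k → ω n j (U⁻¹ k) + q̂ k) Z′) ⟩
    permActInv Q (t translation Z′)
      ≈⟨ permActInv-t (flip w₀∘w₀j) translation Z′ ⟩
    t (translation ∘ Q) (permActInv Q Z′)
      ≈⟨ t-cong {v = permActInv Q Z′} (λ k → sym (ℤ→ℚ-q′ k)) ≈H-refl ⟩
    actW w′ v ∎
    where
    open import Relation.Binary.Reasoning.Setoid ≈H-setoid
    -ω : Vector ℚ (suc n)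
    -ω k = - ω n j k
    Z = permActInv P v
    Z′ = permActInv U⁻¹ Z

theorem4p7 : (n : ℕ) → 1 ≤ n → (w : WElt n) → (j : ℕ) → 1 ≤ j → j ≤ n →
    ((𝓛 (actW w) ≡ 𝓛 (σ n j ∘ actW w))
      × (𝓛 (σ n j ∘ actW w) ≡ 𝓛 (iter (σ n 1) j ∘ actW w)))
    × (Σ (WElt n) (λ w′ → (v : H n) → InH v → actW w′ v ≈H πj n j (actW w) v))
    × (𝓛 (σ n j ∘ πj n j (actW w)) ≡ 𝓛 (actW w ∘ σ n j))
    × (𝓛 (σ n j ∘ πj n j (actW w)) ≡ 𝓛 (πj n j (actW w)))
theorem4p7 n _ w j _ j≤n =
  (σ-invariance , trans (sym σ-invariance) (sym σ₁-iteration-invariance)) ,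
  (w′ , λ v _ → ≈H-sym (πj-actW v)) ,
  htΛ₀-cong (σ-σinv (actW w (σ n j Λ₀))) ,
  htΛ₀-σ (InΛ₀Orbit-resp (πj-actW Λ₀) (actW-InΛ₀Orbit w′))
  where
  j≤1+n = ℕP.m≤n⇒m≤1+n j≤n
  open Sigma j≤1+n
  open Conjugation j≤1+n w
  module σ₁ = Sigma {n} {1} (s≤s z≤n)
  σ-invariance : 𝓛 (actW w) ≡ 𝓛 (σ n j ∘ actW w)
  σ-invariance = sym (htΛ₀-σ (actW-InΛ₀Orbit w))
  σ₁-iteration-invariance : 𝓛 (iter (σ n 1) j ∘ actW w) ≡ 𝓛 (actW w)
  σ₁-iteration-invariance =
    iter-invariant {P = InΛ₀Orbit} {f = σ n 1} σ₁.σ-InΛ₀Orbit (λ v → ht (Λ₀ -H v)) σ₁.htΛ₀-σ j {actW w Λ₀}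
      (actW-InΛ₀Orbit w)
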